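{- Let $P=\{p_1<p_2<\cdots<p_k\}\subseteq[2k+1]$ and let $0\le i\le k+1$ with $i<p_1$. Let $\omega\in O_i(P)$, and let $\omega'$ be obtained from $\omega$ by permuting the elements of $[i]$ among the positions they occupy in $\omega$ (all other entries unchanged). Then $\omega'\in O_i(P)$.
   Context: For a word $\pi=\pi_1\cdots\pi_m$ of distinct integers, $\mathrm{Pin}(\pi)=\{\pi_i:1<i<m,\ \pi_{i-1}<\pi_i>\pi_{i+1}\}$. Let $N=[2k+1]\setminus P=\{n_1<\cdots<n_{k+1}\}$ and $N_i=\{n_1,\ldots,n_i\}$ (the $i$ smallest elements of $N$). For a permutation $\pi$ of $[2k+1]$ and an ordering $\omega$ of a subset $S$, $\mathrm{ord}(\pi)=\omega$ means the elements of $S$ appear in $\pi$ in the same relative order as in $\omega$. Then $O_i(P)$ is the set of all orderings $\omega$ of the set $P\cup N_i$ such that there exists $\pi\in S_{2k+1}$ with $\mathrm{ord}(\pi)=\omega$ and $\mathrm{Pin}(\pi)=P$. (When $i<p_1$, $N_i=[i]$.) -}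

module Defs where

open import Data.Nat using (ℕ; zero; suc; _+_; _*_; _≤_; _<_; _<ᵇ_)
open import Data.Bool using (if_then_else_; _∧_)
open import Data.Nat.Properties using (_≟_)
open import Data.List using (List; []; _∷_; map; upTo; filter; take; _++_; length)
open import Data.List.Membership.DecPropositional _≟_ using (_∈_; _∉_; _∈?_)
open import Data.List.Relation.Unary.All using (All)
open import Data.List.Relation.Unary.Linked using (Linked)
open import Data.List.Relation.Binary.Pointwise using (Pointwise)
open import Data.List.Relation.Binary.Permutation.Propositional using (_↭_)
open import Data.Product using (Σ; _×_; ∃-syntax)
open import Data.Sum using (_⊎_)
open import Relation.Nullary using (¬_; yes; no)
open import Relation.Nullary.Decidable using (¬?)
open import Relation.Binary.PropositionalEquality using (_≡_)
open import Function.Bundles using (_⇔_)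

interval : ℕ → List ℕ
interval n = map suc (upTo n)

Pin : List ℕ → List ℕ
Pin (a ∷ b ∷ c ∷ rest) =
  (if (a <ᵇ b) ∧ (c <ᵇ b) then (b ∷_) else (λ xs → xs)) (Pin (b ∷ c ∷ rest))
Pin _ = []

IsPinSet : ℕ → List ℕ → Set
IsPinSet k P = length P ≡ k × Linked _<_ P × All (λ p → 1 ≤ p × p ≤ 2 * k + 1) P

Nset : ℕ → List ℕ → List ℕ
Nset k P = filter (λ x → ¬? (x ∈? P)) (interval (2 * k + 1))

Nsub : ℕ → List ℕ → ℕ → List ℕ
Nsub k P i = take i (Nset k P)

-- the set P ∪ N_i (as a duplicate-free list; P and N_i are disjoint)
Sset : ℕ → List ℕ → ℕ → List ℕ
Sset k P i = P ++ Nsub k P i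

ordOn : List ℕ → List ℕ → List ℕ
ordOn S π = filter (_∈? S) π

InO : ℕ → List ℕ → ℕ → List ℕ → Set
InO k P i ω =
  ω ↭ Sset k P i ×
  ∃[ π ] (π ↭ interval (2 * k + 1) ×
          ordOn (Sset k P i) π ≡ ω ×
          (∀ x → (x ∈ Pin π) ⇔ (x ∈ P)))

SamePosRel : ℕ → ℕ → ℕ → Set
SamePosRel i a b = ((1 ≤ a × a ≤ i) × (1 ≤ b × b ≤ i)) ⊎ (¬ (1 ≤ a × a ≤ i) × a ≡ b)

PermuteSmall : ℕ → List ℕ → List ℕ → Set
PermuteSmall i ω ω' = ω' ↭ ω × Pointwise (SamePosRel i) ω ω'

{-# OPTIONS --safe #-}
-- Two peaks are never adjacent, so a word x ∷ xs has at most length xs / 2 peaks, and strictly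
-- fewer if it contains two adjacent entries that are not peaks. A witness π of ω ∈ O_i(P) has
-- length 2k + 1 and at least k peaks, all larger than i (they lie in P), so no two entries of [i]
-- are adjacent in π. Each neighbour of an entry of [i] is then outside [i], so its comparison with
-- that entry does not depend on which element of [i] sits there: exchanging the entries of [i]
-- inside π as ω' does inside ω leaves Pin unchanged, and the resulting word witnesses ω' ∈ O_i(P).
module Submission where

open import Defs
open import Data.Nat using (ℕ; zero; suc; _≤_; _<_; _+_; _*_; _<ᵇ_; z≤n; s≤s; _≤?_)
open import Data.Nat.Properties
  using (_≟_; <ᵇ⇒<; <⇒<ᵇ; <⇒≤; <⇒≱; <⇒≢; ≰⇒>; ≤-<-trans; ≤-trans; ≤-reflexive; *-suc; *-monoʳ-≤;
         m≤n⇒m≤1+n; m<n⇒m<1+n; +-comm; suc-injective; <-trans)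
open import Data.Bool using (true; false; _∧_)
open import Data.Bool.Properties using (T-≡)
open import Data.List using (List; []; _∷_; length; filter; _++_; upTo)
open import Data.List.Properties using (filter-accept; filter-reject; length-map; length-upTo; partition-defn)
open import Data.List.Relation.Unary.All as All using (All; []; _∷_)
open import Data.List.Relation.Unary.Any as Any using ()
open import Data.List.Relation.Unary.AllPairs as AllPairs using ([]; _∷_)
open import Data.List.Relation.Unary.Unique.Propositional using (Unique)
open import Data.List.Relation.Unary.Linked.Properties using (Linked⇒AllPairs)
open import Data.List.Relation.Binary.Pointwise using (Pointwise; []; _∷_)
open import Data.List.Relation.Binary.Permutation.Propositional using (_↭_; ↭-sym; ↭-trans; ↭-reflexive; ↭ₛ⇒↭)
open import Data.List.Relation.Binary.Permutation.Propositional.Properties using (∈-resp-↭; ↭-length; ++⁺; shift)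
open import Data.List.Relation.Binary.Permutation.Setoid.Properties as ↭ₛ using ()
open import Data.List.Relation.Binary.Subset.Propositional using (_⊆_)
open import Data.List.Membership.Propositional using (_∈_)
open import Data.List.Membership.Propositional.Properties using (∈-∃++)
open import Data.List.Membership.DecPropositional _≟_ using (_∈?_)
open import Data.Product using (_×_; _,_; proj₂; ∃-syntax; uncurry; swap)
open import Data.Sum using (_⊎_; inj₁; inj₂)
open import Function using (_∘_)
open import Function.Bundles using (_⇔_; Equivalence)
open import Level using (Level)
open import Relation.Nullary using (¬_; yes; no; contradiction)
open import Relation.Nullary.Decidable using (_×-dec_)
open import Relation.Unary using (Pred; Decidable; ∁)
open import Relation.Unary.Properties using (∁?)
open import Relation.Binary using (Rel; Reflexive)
open import Relation.Binary.PropositionalEquality using (_≡_; refl; sym; trans; cong; cong₂; subst; subst₂; setoid)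

private
  variable
    a ℓ ℓ′ : Level
    A : Set a
    m n : ℕ

<⇒<ᵇ≡true : m < n → (m <ᵇ n) ≡ true
<⇒<ᵇ≡true = Equivalence.to T-≡ ∘ <⇒<ᵇ

<ᵇ≡true⇒< : (m <ᵇ n) ≡ true → m < n
<ᵇ≡true⇒< {m} {n} = <ᵇ⇒< m n ∘ Equivalence.from T-≡

≤⇒<ᵇ≡false : n ≤ m → (m <ᵇ n) ≡ false
≤⇒<ᵇ≡false {n} {m} n≤m with m <ᵇ n in m<ᵇn
... | false = refl
... | true  = contradiction n≤m (<⇒≱ (<ᵇ≡true⇒< m<ᵇn))

length-interval : ∀ n → length (interval n) ≡ n
length-interval n = trans (length-map suc (upTo n)) (length-upTo n)

⊆⇒length≤ : ∀ {xs ys : List A} → Unique xs → xs ⊆ ys → length xs ≤ length ys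
⊆⇒length≤ [] _ = z≤n
⊆⇒length≤ {xs = x ∷ xs} (x≢xs ∷ uniq) xs⊆ys with as , bs , refl ← ∈-∃++ (xs⊆ys (Any.here refl)) =
  subst (suc (length xs) ≤_) (sym (↭-length x-moved)) (s≤s (⊆⇒length≤ uniq xs⊆as++bs))
  where
  x-moved : as ++ x ∷ bs ↭ x ∷ as ++ bs
  x-moved = shift x as bs
  xs⊆as++bs : xs ⊆ as ++ bs
  xs⊆as++bs y∈xs with ∈-resp-↭ x-moved (xs⊆ys (Any.there y∈xs))
  ... | Any.here refl = contradiction refl (All.lookup x≢xs y∈xs)
  ... | Any.there y∈as++bs = y∈as++bs

module _ {P : Pred A ℓ} (P? : Decidable P) where

  ↭-filter-split : ∀ xs → xs ↭ filter P? xs ++ filter (∁? P?) xs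
  ↭-filter-split xs =
    subst (λ (ys , zs) → xs ↭ ys ++ zs) (partition-defn P? xs) (↭ₛ⇒↭ (↭ₛ.partition-↭ (setoid _) P? xs))

  filters⇒↭ : ∀ {xs ys} → filter P? xs ↭ filter P? ys → filter (∁? P?) xs ≡ filter (∁? P?) ys → xs ↭ ys
  filters⇒↭ {xs} {ys} p q =
    ↭-trans (↭-filter-split xs) (↭-trans (++⁺ p (↭-reflexive q)) (↭-sym (↭-filter-split ys)))

  filter-substitute : ∀ {R : Rel A ℓ′} → Reflexive R → ∀ xs {ws} → Pointwise R (filter P? xs) ws → All P ws →
                      ∃[ ys ] Pointwise R xs ys × filter P? ys ≡ ws × filter (∁? P?) ys ≡ filter (∁? P?) xs
  filter-substitute R-refl [] [] [] = [] , [] , refl , refl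
  filter-substitute R-refl (x ∷ xs) pw pws with P? x
  filter-substitute R-refl (x ∷ xs) (x~w ∷ pw) (pw₀ ∷ pws) | yes px
    with ys , xs~ys , filter-ys , rest-ys ← filter-substitute R-refl xs pw pws =
    _ ∷ ys , x~w ∷ xs~ys ,
    trans (filter-accept P? pw₀) (cong (_ ∷_) filter-ys) ,
    trans (filter-reject (∁? P?) (λ ¬pw₀ → ¬pw₀ pw₀)) rest-ys
  ... | no ¬px with ys , xs~ys , filter-ys , rest-ys ← filter-substitute R-refl xs pw pws =
    x ∷ ys , R-refl ∷ xs~ys ,
    trans (filter-reject P? ¬px) filter-ys ,
    trans (filter-accept (∁? P?) ¬px) (cong (x ∷_) rest-ys)

Pin-descent : ∀ {b c} r → c < b → Pin (b ∷ c ∷ r) ≡ Pin (c ∷ r)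
Pin-descent [] _ = refl
Pin-descent (d ∷ r) c<b rewrite ≤⇒<ᵇ≡false (<⇒≤ c<b) = refl

length-Pin : ∀ x xs → 2 * length (Pin (x ∷ xs)) ≤ length xs
length-Pin x [] = z≤n
length-Pin x (y ∷ []) = z≤n
length-Pin a (b ∷ c ∷ r) with length-Pin b (c ∷ r) | length-Pin c r | a <ᵇ b | c <ᵇ b in c<ᵇb
... | _  | ih | true  | true =
  subst (λ p → 2 * length (b ∷ p) ≤ _) (sym (Pin-descent r (<ᵇ≡true⇒< c<ᵇb)))
        (≤-trans (≤-reflexive (*-suc 2 _)) (s≤s (s≤s ih)))
... | ih | _  | true  | false = m≤n⇒m≤1+n ih
... | ih | _  | false | _     = m≤n⇒m≤1+n ih

data AdjacentPair {A : Set a} (Q : Pred A ℓ) : List A → Set (a Level.⊔ ℓ) where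
  here  : ∀ {x y zs} → Q x → Q y → AdjacentPair Q (x ∷ y ∷ zs)
  there : ∀ {x zs} → AdjacentPair Q zs → AdjacentPair Q (x ∷ zs)

module _ {Q : Pred ℕ ℓ} where

  length-Pin-<-second : ∀ {a b c r} → Q b → All (∁ Q) (Pin (a ∷ b ∷ c ∷ r)) →
                        2 * length (Pin (a ∷ b ∷ c ∷ r)) < length (b ∷ c ∷ r)
  length-Pin-<-second {a} {b} {c} {r} qb noQ with (a <ᵇ b) ∧ (c <ᵇ b)
  ... | true  = contradiction qb (All.head noQ)
  ... | false = s≤s (length-Pin b (c ∷ r))

  length-Pin-< : ∀ x xs → AdjacentPair Q (x ∷ xs) → All (∁ Q) (Pin (x ∷ xs)) →
                 2 * length (Pin (x ∷ xs)) < length xs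
  length-Pin-< a [] (there ()) _
  length-Pin-< a (b ∷ []) _ _ = s≤s z≤n
  length-Pin-< a (b ∷ c ∷ r) (here _ qb) noQ = length-Pin-<-second {r = r} qb noQ
  length-Pin-< a (b ∷ c ∷ r) (there (here qb _)) noQ = length-Pin-<-second {r = r} qb noQ
  length-Pin-< a (b ∷ c ∷ r) (there (there adj)) noQ
    with length-Pin-< b (c ∷ r) (there adj) | length-Pin-< c r adj | a <ᵇ b | c <ᵇ b in c<ᵇb
  ... | _  | ih | true  | true =
    subst (λ p → 2 * length (b ∷ p) < _) (sym Pin-bcr≡Pin-cr)
          (≤-trans (≤-reflexive (cong suc (*-suc 2 _)))
                   (s≤s (s≤s (ih (subst (All (∁ Q)) Pin-bcr≡Pin-cr (All.tail noQ))))))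
    where Pin-bcr≡Pin-cr = Pin-descent r (<ᵇ≡true⇒< c<ᵇb)
  ... | ih | _  | true  | false = m<n⇒m<1+n (ih noQ)
  ... | ih | _  | false | _     = m<n⇒m<1+n (ih noQ)

  ¬AdjacentPair-of-k-peaks : ∀ k π → length π ≡ 2 * k + 1 → k ≤ length (Pin π) → All (∁ Q) (Pin π) →
                             ¬ AdjacentPair Q π
  ¬AdjacentPair-of-k-peaks k (x ∷ xs) |π|≡2k+1 k≤|Pin| noQ adj =
    <⇒≱ (length-Pin-< x xs adj noQ)
        (subst (_≤ 2 * length (Pin (x ∷ xs))) (sym |xs|≡2k) (*-monoʳ-≤ 2 k≤|Pin|))
    where |xs|≡2k = suc-injective (trans |π|≡2k+1 (+-comm (2 * k) 1))

Small : ℕ → ℕ → Set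
Small i x = 1 ≤ x × x ≤ i

module _ {i : ℕ} where

  ¬Small⇒≡0⊎> : ¬ Small i n → n ≡ 0 ⊎ i < n
  ¬Small⇒≡0⊎> {zero} _ = inj₁ refl
  ¬Small⇒≡0⊎> {suc n} ¬small with suc n ≤? i
  ... | yes 1+n≤i = contradiction (s≤s z≤n , 1+n≤i) ¬small
  ... | no 1+n≰i = inj₂ (≰⇒> 1+n≰i)

  <ᵇ-non-small : Small i m → ¬ Small i n → (m <ᵇ n) ≡ (i <ᵇ n)
  <ᵇ-non-small (_ , m≤i) ¬small with ¬Small⇒≡0⊎> ¬small
  ... | inj₁ refl = refl
  ... | inj₂ i<n = trans (<⇒<ᵇ≡true (≤-<-trans m≤i i<n)) (sym (<⇒<ᵇ≡true i<n))

  non-small-<ᵇ : ¬ Small i m → Small i n → (m <ᵇ n) ≡ (m <ᵇ 1)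
  non-small-<ᵇ ¬small (s≤s z≤n , n≤i) with ¬Small⇒≡0⊎> ¬small
  ... | inj₁ refl = refl
  ... | inj₂ i<m = trans (≤⇒<ᵇ≡false (≤-trans n≤i (<⇒≤ i<m)))
                         (sym (≤⇒<ᵇ≡false (≤-trans (s≤s z≤n) i<m)))

  SamePosRel-refl : Reflexive (SamePosRel i)
  SamePosRel-refl {x} with (1 ≤? x) ×-dec (x ≤? i)
  ... | yes small = inj₁ (small , small)
  ... | no ¬small = inj₂ (¬small , refl)

  <ᵇ-resp-SamePosRel : ∀ {a a' b b'} → SamePosRel i a a' → SamePosRel i b b' → ¬ (Small i a × Small i b) →
                       (a <ᵇ b) ≡ (a' <ᵇ b')
  <ᵇ-resp-SamePosRel (inj₁ (sa , _)) (inj₁ (sb , _)) ¬both = contradiction (sa , sb) ¬both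
  <ᵇ-resp-SamePosRel (inj₂ (_ , refl)) (inj₂ (_ , refl)) _ = refl
  <ᵇ-resp-SamePosRel (inj₁ (sa , sa')) (inj₂ (¬sb , refl)) _ =
    trans (<ᵇ-non-small sa ¬sb) (sym (<ᵇ-non-small sa' ¬sb))
  <ᵇ-resp-SamePosRel (inj₂ (¬sa , refl)) (inj₁ (sb , sb')) _ =
    trans (non-small-<ᵇ ¬sa sb) (sym (non-small-<ᵇ ¬sa sb'))

  Pin-resp-SamePosRel : ∀ {π π'} → Pointwise (SamePosRel i) π π' → ¬ AdjacentPair (Small i) π →
                        All (∁ (Small i)) (Pin π) → Pin π ≡ Pin π'
  Pin-resp-SamePosRel [] _ _ = refl
  Pin-resp-SamePosRel (_ ∷ []) _ _ = refl
  Pin-resp-SamePosRel (_ ∷ _ ∷ []) _ _ = refl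
  Pin-resp-SamePosRel {a ∷ b ∷ c ∷ r} {a' ∷ b' ∷ c' ∷ r'} (ra ∷ rest@(rb ∷ rc ∷ _)) ¬adj noSmall
    with Pin-resp-SamePosRel rest (¬adj ∘ there)
       | a <ᵇ b | a' <ᵇ b' | <ᵇ-resp-SamePosRel ra rb (¬adj ∘ uncurry here)
       | c <ᵇ b | c' <ᵇ b' | <ᵇ-resp-SamePosRel rc rb (¬adj ∘ there ∘ uncurry here ∘ swap)
  ... | ih | true  | .true  | refl | true  | .true  | refl =
    cong₂ _∷_ (non-small-fixed rb (All.head noSmall)) (ih (All.tail noSmall))
    where
    non-small-fixed : SamePosRel i b b' → ¬ Small i b → b ≡ b'
    non-small-fixed (inj₁ (sb , _)) ¬sb = contradiction sb ¬sb
    non-small-fixed (inj₂ (_ , b≡b')) _ = b≡b'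
  ... | ih | true  | .true  | refl | false | .false | refl = ih noSmall
  ... | ih | false | .false | refl | _     | _      | refl = ih noSmall

Pin-resp-small-substitution : ∀ {i} k {π π'} → length π ≡ 2 * k + 1 → k ≤ length (Pin π) →
                              All (∁ (Small i)) (Pin π) → Pointwise (SamePosRel i) π π' → Pin π ≡ Pin π'
Pin-resp-small-substitution k {π} |π|≡2k+1 k≤|Pin| peaks-large π~π' =
  Pin-resp-SamePosRel π~π' (¬AdjacentPair-of-k-peaks k π |π|≡2k+1 k≤|Pin| peaks-large) peaks-large

mainTheorem5 : (k : ℕ) (P : List ℕ) (i : ℕ) → IsPinSet k P → i ≤ k + 1 →
               All (λ p → i < p) P →
               (ω ω' : List ℕ) → InO k P i ω → PermuteSmall i ω ω' → InO k P i ω'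
mainTheorem5 k P i (|P|≡k , P-increasing , _) _ P>i ω ω' (ω↭S , π , π↭[2k+1] , ordπ≡ω , Pinπ⇔P) (ω'↭ω , ω~ω')
  with π' , π~π' , ordπ'≡ω' , rest≡ ←
         filter-substitute (_∈? Sset k P i) SamePosRel-refl π
           (subst (λ o → Pointwise (SamePosRel i) o ω') (sym ordπ≡ω) ω~ω')
           (All.tabulate (∈-resp-↭ (↭-trans ω'↭ω ω↭S))) =
  ↭-trans ω'↭ω ω↭S , π' , ↭-trans π'↭π π↭[2k+1] , ordπ'≡ω' ,
  (λ x → subst (λ Q → (x ∈ Q) ⇔ (x ∈ P)) Pinπ≡Pinπ' (Pinπ⇔P x))
  where
  π'↭π : π' ↭ π
  π'↭π = filters⇒↭ (_∈? Sset k P i) (subst₂ _↭_ (sym ordπ'≡ω') (sym ordπ≡ω) ω'↭ω) rest≡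
  k≤|Pinπ| : k ≤ length (Pin π)
  k≤|Pinπ| = subst (_≤ _) |P|≡k
    (⊆⇒length≤ (AllPairs.map <⇒≢ (Linked⇒AllPairs <-trans P-increasing)) (Equivalence.from (Pinπ⇔P _)))
  peaks-large : All (∁ (Small i)) (Pin π)
  peaks-large = All.tabulate (λ x∈Pin small → <⇒≱ (All.lookup P>i (Equivalence.to (Pinπ⇔P _) x∈Pin)) (proj₂ small))
  Pinπ≡Pinπ' : Pin π ≡ Pin π'
  Pinπ≡Pinπ' =
    Pin-resp-small-substitution k (trans (↭-length π↭[2k+1]) (length-interval _)) k≤|Pinπ| peaks-large π~π'
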